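{- Let $(G,T)$ be a generated group with $T=T^{ -1}$ and $T$ closed under $G$-conjugation. If $\ell(tg)<\ell(g)$ for some $t\in T$ and $g\in G$, then there is a $T$-reduced word $g=t_1\cdots t_k$ and an index $i$ such that $tg={}^{t}t_1\cdots{}^{t}t_{i-1}\cdot t_{i+1}\cdots t_k$.
   Context: A generated group is a pair $(G,T)$ with $G$ a group and $T\subseteq G$ generating $G$ as a monoid; $\ell(g)=\ell_T(g)$ is the minimum $\ell$ with $g=t_1\cdots t_\ell$, $t_i\in T$ ($\ell(e)=0$), and a $T$-reduced word for $g$ is such an expression of length $\ell(g)$. Notation: ${}^{h}g:=hgh^{ -1}$. -}

module Defs where

open import Level using (Level; _⊔_)
open import Algebra.Bundles using (Group)
open import Data.Nat using (ℕ; _≤_; _<_)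
open import Data.List using (List; []; _∷_; length; foldr)
open import Data.List.Relation.Unary.All using (All)
open import Data.Product using (Σ; _×_)

module _ {c ℓ p : Level} (G : Group c ℓ) (T : Group.Carrier G → Set p) where
  open Group G

  prod : List Carrier → Carrier
  prod = foldr _∙_ ε

  conj : Carrier → Carrier → Carrier
  conj h g = (h ∙ g) ∙ h ⁻¹

  IsWordFor : Carrier → List Carrier → Set (c ⊔ ℓ ⊔ p)
  IsWordFor g w = All T w × prod w ≈ g

  IsReducedWord : Carrier → List Carrier → Set (c ⊔ ℓ ⊔ p)
  IsReducedWord g w = IsWordFor g w × (∀ w′ → IsWordFor g w′ → length w ≤ length w′)

  HasLength : Carrier → ℕ → Set (c ⊔ ℓ ⊔ p)
  HasLength g n = Σ (List Carrier) (λ w → IsReducedWord g w × length w ≡ℕ n)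
    where open import Relation.Binary.PropositionalEquality renaming (_≡_ to _≡ℕ_)

  GeneratesAsMonoid : Set (c ⊔ ℓ ⊔ p)
  GeneratesAsMonoid = ∀ g → Σ (List Carrier) (IsWordFor g)

module Submission where

open import Defs
open import Level using (Level)
open import Algebra.Bundles using (Group)
import Algebra.Properties.Group as GroupProperties
open import Data.Nat using (ℕ; suc; _≤_; _<_)
open import Data.Nat.Properties using (≤-trans)
open import Data.Fin using (Fin; toℕ; zero)
open import Data.List using (List; _∷_; map; take; drop; _++_; length)
open import Data.List.Relation.Unary.All using (_∷_)
open import Data.Product using (Σ; _×_; _,_; proj₂)
open import Relation.Binary.PropositionalEquality using (refl)

-- Since g = t⁻¹ (tg) with t⁻¹ ∈ T, we have ℓ(g) ≤ ℓ(tg) + 1, so ℓ(tg) < ℓ(g) forces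
-- equality: t⁻¹ followed by a reduced word for tg is a reduced word for g, and deleting
-- its first letter (i = 1, no conjugated letters) leaves tg.

module _ {c ℓ p : Level} (G : Group c ℓ) (T : Group.Carrier G → Set p) where
  open Group G
  open GroupProperties G using (\\-leftDividesʳ)

  IsWordFor-resp-≈ : ∀ {g h w} → g ≈ h → IsWordFor G T g w → IsWordFor G T h w
  IsWordFor-resp-≈ g≈h (wT , w≈g) = wT , trans w≈g g≈h

  IsWordFor-∷ : ∀ {s h w} → T s → IsWordFor G T h w → IsWordFor G T (s ∙ h) (s ∷ w)
  IsWordFor-∷ sT (wT , w≈h) = sT ∷ wT , ∙-congˡ w≈h

  IsWordFor-⁻¹∷ : ∀ {t g w} → T (t ⁻¹) → IsWordFor G T (t ∙ g) w →
                  IsWordFor G T g (t ⁻¹ ∷ w)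
  IsWordFor-⁻¹∷ {t} {g} t⁻¹T w-tg =
    IsWordFor-resp-≈ (\\-leftDividesʳ t g) (IsWordFor-∷ t⁻¹T w-tg)

  length≤⇒IsReducedWord : ∀ {g n w} → HasLength G T g n → IsWordFor G T g w →
                          length w ≤ n → IsReducedWord G T g w
  length≤⇒IsReducedWord (_ , (_ , minimal) , refl) w-g w≤n =
    w-g , λ w′ w′-g → ≤-trans w≤n (minimal w′ w′-g)

proposition2p21 : {c ℓ p : Level} (G : Group c ℓ) (T : Group.Carrier G → Set p) →
    let open Group G in
    (∀ {x y} → x ≈ y → T x → T y) →
    GeneratesAsMonoid G T →
    (∀ s → T s → T (s ⁻¹)) →
    (∀ h s → T s → T (conj G T h s)) →
    (t g : Carrier) → T t →
    (m n : ℕ) → HasLength G T (t ∙ g) m → HasLength G T g n → m < n →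
    Σ (List Carrier) (λ w → IsReducedWord G T g w ×
      Σ (Fin (length w)) (λ i →
        t ∙ g ≈ prod G T (map (conj G T t) (take (toℕ i) w) ++ drop (suc (toℕ i)) w)))
proposition2p21 G T _ _ T-⁻¹ _ t g tT _ _ (v , (v-tg , _) , refl) ℓg≡n m<n =
  t ⁻¹ ∷ v , length≤⇒IsReducedWord G T ℓg≡n w-g m<n , zero , sym (proj₂ v-tg)
  where
  open Group G
  w-g : IsWordFor G T g (t ⁻¹ ∷ v)
  w-g = IsWordFor-⁻¹∷ G T (T-⁻¹ t tT) v-tg
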